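{- If $2\le i\le j$ are integers, then there exists a finite connected loopless multigraph $G$ with $\operatorname{gon}(G)=i$ and $\operatorname{mfgon}(G)=j$.
   Context: Graphs are finite, connected, and may have multiple edges but no loops. A divisor is an integer combination $D=\sum_vD(v)(v)$ of vertices, degree $\sum_vD(v)$, effective if all $D(v)\ge0$. Divisors are equivalent if their difference lies in the integer column space of the Laplacian (diagonal entries are valences, off-diagonal entries are minus the number of edges). The rank $r(D)$ is $-1$ if $D$ is not equivalent to an effective divisor, else the largest $r\ge0$ such that $D-E$ is equivalent to an effective divisor for all effective $E$ of degree $r$. $\operatorname{gon}(G)$ is the minimum degree of a positive-rank divisor; $\operatorname{mfgon}(G)$ is the minimum degree of a positive-rank effective divisor $D$ with $D(v)\le1$ for all $v$. -}

module Defs where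

open import Data.Nat using (ℕ; zero; suc) renaming (_≤_ to _≤ℕ_)
open import Data.Fin using (Fin; zero; suc)
open import Data.Fin.Properties using () renaming (_≟_ to _≟ᶠ_)
open import Data.Integer using (ℤ; +_; _+_; _-_; _*_; -_; _≤_)
open import Data.Product using (Σ; _×_; ∃)
open import Relation.Nullary using (¬_; yes; no)
open import Relation.Binary.PropositionalEquality using (_≡_)

sumFin : ∀ {n} → (Fin n → ℤ) → ℤ
sumFin {zero}  f = + 0
sumFin {suc n} f = f zero + sumFin (λ i → f (suc i))

sumFinℕ : ∀ {n} → (Fin n → ℕ) → ℕ
sumFinℕ {zero}  f = 0
sumFinℕ {suc n} f = Data.Nat._+_ (f zero) (sumFinℕ (λ i → f (suc i)))

record Multigraph : Set where
  field
    n        : ℕ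
    mult     : Fin n → Fin n → ℕ
    symm     : ∀ u v → mult u v ≡ mult v u
    loopless : ∀ v → mult v v ≡ 0

open Multigraph public

data Reach (G : Multigraph) : Fin (n G) → Fin (n G) → Set where
  here : ∀ {v} → Reach G v v
  step : ∀ {u w v} → 1 ≤ℕ mult G u w → Reach G w v → Reach G u v

Connected : Multigraph → Set
Connected G = (1 ≤ℕ n G) × (∀ u v → Reach G u v)

module _ (G : Multigraph) where

  Divisor : Set
  Divisor = Fin (n G) → ℤ

  deg : Divisor → ℤ
  deg D = sumFin D

  Effective : Divisor → Set
  Effective D = ∀ v → + 0 ≤ D v

  valence : Fin (n G) → ℕ
  valence v = sumFinℕ (mult G v)

  laplacian : Fin (n G) → Fin (n G) → ℤ
  laplacian u v with u ≟ᶠ v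
  ... | yes _ = + valence u
  ... | no  _ = - (+ mult G u v)

  applyLaplacian : (Fin (n G) → ℤ) → Divisor
  applyLaplacian z u = sumFin (λ v → laplacian u v * z v)

  _∼_ : Divisor → Divisor → Set
  D ∼ D' = Σ (Fin (n G) → ℤ) λ z → ∀ v → D v - D' v ≡ applyLaplacian z v

  EquivEffective : Divisor → Set
  EquivEffective D = Σ Divisor λ D' → Effective D' × (D ∼ D')

  _⊖_ : Divisor → Divisor → Divisor
  (D ⊖ E) v = D v - E v

  RankProperty : Divisor → ℕ → Set
  RankProperty D r = ∀ (E : Divisor) → Effective E → deg E ≡ + r → EquivEffective (D ⊖ E)

  data RankValue : Set where
    minusOne : RankValue
    nonneg   : ℕ → RankValue

  data HasRank (D : Divisor) : RankValue → Set where
    rank-1 : ¬ EquivEffective D → HasRank D minusOne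
    rank≥0 : ∀ {r} → EquivEffective D → RankProperty D r
           → (∀ r' → suc r ≤ℕ r' → ¬ RankProperty D r') → HasRank D (nonneg r)

  PositiveRank : Divisor → Set
  PositiveRank D = Σ ℕ λ r → 1 ≤ℕ r × HasRank D (nonneg r)

  IsGon : ℕ → Set
  IsGon k = (Σ Divisor λ D → PositiveRank D × deg D ≡ + k)
          × (∀ D → PositiveRank D → + k ≤ deg D)

  MultiplicityFree : Divisor → Set
  MultiplicityFree D = Effective D × (∀ v → D v ≤ + 1)

  IsMfgon : ℕ → Set
  IsMfgon k = (Σ Divisor λ D → MultiplicityFree D × PositiveRank D × deg D ≡ + k)
            × (∀ D → MultiplicityFree D → PositiveRank D → + k ≤ deg D)

{-# OPTIONS --safe #-}
-- The witness is the star with one centre and j − 1 leaves, each leaf joined to the centre by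
-- i parallel edges. Firing moves chips between a leaf and the centre in multiples of i, so a
-- divisor with all entries below i is the only effective divisor in its class. Hence if a
-- positive-rank divisor has such a small effective representative, subtracting any vertex must
-- leave that representative effective, so it is at least 1 everywhere and has degree at least j;
-- otherwise the representative has an entry of size at least i. This gives gon ≥ i and
-- mfgon ≥ j; i times the centre and the all-ones divisor have rank exactly 1, since removing
-- the centre from them leaves a small divisor vanishing at some vertex.
module Submission where

open import Defs
open import Data.Nat using (ℕ; _≤_)
open import Data.Product using (Σ; _×_)

open import Data.Nat using (zero; suc; z≤n; s≤s)
import Data.Nat.Properties as ℕP
open import Data.Integer as ℤ using (ℤ; +_; _+_; _-_; _*_; -_; 0ℤ; 1ℤ; +≤+; +<+)
import Data.Integer.Properties as ℤP
open import Algebra.Properties.CommutativeSemigroup ℤP.+-commutativeSemigroup using (interchange)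
open import Algebra.Properties.Ring ℤP.+-*-ring using (x[y-z]≈xy-xz)
open import Data.Integer.Tactic.RingSolver using (solve-∀)
open import Data.Fin using (Fin; zero; suc)
open import Data.Fin.Properties using (all?; ¬∀⟶∃¬) renaming (_≟_ to _≟ᶠ_)
open import Data.Product using (_,_)
open import Data.Sum using (inj₁; inj₂)
open import Function using (_∘_)
open import Relation.Nullary using (¬_; yes; no; contradiction)
open import Relation.Binary.PropositionalEquality

sumFin-cong : ∀ {n} {f g : Fin n → ℤ} → (∀ v → f v ≡ g v) → sumFin f ≡ sumFin g
sumFin-cong {zero}  f≗g = refl
sumFin-cong {suc n} f≗g = cong₂ _+_ (f≗g zero) (sumFin-cong (f≗g ∘ suc))

sumFin-zero : ∀ {n} → sumFin {n} (λ _ → 0ℤ) ≡ 0ℤ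
sumFin-zero {zero}  = refl
sumFin-zero {suc n} = trans (ℤP.+-identityˡ _) (sumFin-zero {n})

sumFin-one : ∀ {n} → sumFin {n} (λ _ → 1ℤ) ≡ + n
sumFin-one {zero}  = refl
sumFin-one {suc n} = cong (λ s → 1ℤ + s) (sumFin-one {n})

sumFin-distrib-+ : ∀ {n} (f g : Fin n → ℤ) → sumFin (λ v → f v + g v) ≡ sumFin f + sumFin g
sumFin-distrib-+ {zero}  f g = refl
sumFin-distrib-+ {suc n} f g =
  trans (cong (λ s → f zero + g zero + s) (sumFin-distrib-+ (f ∘ suc) (g ∘ suc)))
        (interchange (f zero) (g zero) _ _)

sumFin-neg : ∀ {n} (f : Fin n → ℤ) → sumFin (λ v → - f v) ≡ - sumFin f
sumFin-neg {zero}  f = refl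
sumFin-neg {suc n} f =
  trans (cong (λ s → - f zero + s) (sumFin-neg (f ∘ suc)))
        (sym (ℤP.neg-distrib-+ (f zero) _))

sumFin-distrib-sub : ∀ {n} (f g : Fin n → ℤ) → sumFin (λ v → f v - g v) ≡ sumFin f - sumFin g
sumFin-distrib-sub f g =
  trans (sumFin-distrib-+ f (λ v → - g v)) (cong (λ s → sumFin f + s) (sumFin-neg g))

*-distribˡ-sumFin : ∀ {n} c (f : Fin n → ℤ) → c * sumFin f ≡ sumFin (λ v → c * f v)
*-distribˡ-sumFin {zero}  c f = ℤP.*-zeroʳ c
*-distribˡ-sumFin {suc n} c f =
  trans (ℤP.*-distribˡ-+ c (f zero) _) (cong (λ s → c * f zero + s) (*-distribˡ-sumFin c (f ∘ suc)))

*-distribʳ-sumFin : ∀ {n} c (f : Fin n → ℤ) → sumFin f * c ≡ sumFin (λ v → f v * c)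
*-distribʳ-sumFin c f =
  trans (ℤP.*-comm _ c) (trans (*-distribˡ-sumFin c f) (sumFin-cong (λ v → ℤP.*-comm c (f v))))

sumFin-comm : ∀ {m n} (f : Fin m → Fin n → ℤ) →
              sumFin (λ u → sumFin (f u)) ≡ sumFin (λ v → sumFin (λ u → f u v))
sumFin-comm {zero} {n} f = sym (sumFin-zero {n})
sumFin-comm {suc m} f =
  trans (cong (λ s → sumFin (f zero) + s) (sumFin-comm (f ∘ suc)))
        (sym (sumFin-distrib-+ (f zero) _))

pos-sumFinℕ : ∀ {n} (f : Fin n → ℕ) → + sumFinℕ f ≡ sumFin (λ v → + f v)
pos-sumFinℕ {zero}  f = refl
pos-sumFinℕ {suc n} f = trans (ℤP.pos-+ (f zero) _) (cong (λ s → + f zero + s) (pos-sumFinℕ (f ∘ suc)))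

sumFin-nonneg : ∀ {n} {f : Fin n → ℤ} → (∀ v → 0ℤ ℤ.≤ f v) → 0ℤ ℤ.≤ sumFin f
sumFin-nonneg {zero}  0≤f = +≤+ z≤n
sumFin-nonneg {suc n} 0≤f = ℤP.+-mono-≤ (0≤f zero) (sumFin-nonneg (0≤f ∘ suc))

entry≤sumFin : ∀ {n} {f : Fin n → ℤ} → (∀ v → 0ℤ ℤ.≤ f v) → ∀ v → f v ℤ.≤ sumFin f
entry≤sumFin {suc n} {f} 0≤f zero =
  ℤP.≤-trans (ℤP.≤-reflexive (sym (ℤP.+-identityʳ (f zero))))
             (ℤP.+-monoʳ-≤ (f zero) (sumFin-nonneg (0≤f ∘ suc)))
entry≤sumFin {suc n} {f} 0≤f (suc v) =
  ℤP.≤-trans (ℤP.≤-reflexive (sym (ℤP.+-identityˡ (f (suc v)))))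
             (ℤP.+-mono-≤ (0≤f zero) (entry≤sumFin (0≤f ∘ suc) v))

n≤sumFin : ∀ {n} {f : Fin n → ℤ} → (∀ v → 1ℤ ℤ.≤ f v) → + n ℤ.≤ sumFin f
n≤sumFin {zero}  1≤f = +≤+ z≤n
n≤sumFin {suc n} 1≤f = ℤP.+-mono-≤ (1≤f zero) (n≤sumFin (1≤f ∘ suc))

nonneg-sumFin≤0⇒≡0 : ∀ {n} {f : Fin n → ℤ} → (∀ v → 0ℤ ℤ.≤ f v) → sumFin f ℤ.≤ 0ℤ → ∀ v → f v ≡ 0ℤ
nonneg-sumFin≤0⇒≡0 0≤f ∑f≤0 v = ℤP.≤-antisym (ℤP.≤-trans (entry≤sumFin 0≤f v) ∑f≤0) (0≤f v)

x-y≡c*s⇒s≤0 : ∀ {c x y s} → .{{ℤ.NonNegative c}} →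
              x ℤ.< c → 0ℤ ℤ.≤ y → x - y ≡ c * s → s ℤ.≤ 0ℤ
x-y≡c*s⇒s≤0 {c} {x} {y} {s} x<c 0≤y x-y≡cs with s ℤ.≤? 0ℤ
... | yes s≤0 = s≤0
... | no  s≰0 = contradiction (ℤP.<-≤-trans x<c c≤x) (ℤP.<-irrefl refl)
  where
  open ℤP.≤-Reasoning
  c≤x : c ℤ.≤ x
  c≤x = begin
    c      ≡⟨ ℤP.*-identityʳ c ⟨
    c * 1ℤ ≤⟨ ℤP.*-monoˡ-≤-nonNeg c (ℤP.i<j⇒suc[i]≤j (ℤP.≰⇒> s≰0)) ⟩
    c * s  ≡⟨ x-y≡cs ⟨
    x - y  ≤⟨ ℤP.i-j≤i x y {{ℤ.nonNegative 0≤y}} ⟩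
    x      ∎

point : ∀ {n} → Fin n → ℕ → Fin n → ℤ
point zero    r zero    = + r
point zero    r (suc _) = 0ℤ
point (suc v) r zero    = 0ℤ
point (suc v) r (suc u) = point v r u

point-self : ∀ {n} (v : Fin n) r → point v r v ≡ + r
point-self zero    r = refl
point-self (suc v) r = point-self v r

point-other : ∀ {n} {v u : Fin n} r → u ≢ v → point v r u ≡ 0ℤ
point-other {v = zero}  {zero}  r u≢v = contradiction refl u≢v
point-other {v = zero}  {suc u} r u≢v = refl
point-other {v = suc v} {zero}  r u≢v = refl
point-other {v = suc v} {suc u} r u≢v = point-other r (u≢v ∘ cong suc)

point-nonneg : ∀ {n} (v : Fin n) r u → 0ℤ ℤ.≤ point v r u
point-nonneg zero    r zero    = +≤+ z≤n
point-nonneg zero    r (suc u) = +≤+ z≤n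
point-nonneg (suc v) r zero    = +≤+ z≤n
point-nonneg (suc v) r (suc u) = point-nonneg v r u

sumFin-point : ∀ {n} (v : Fin n) r → sumFin (point v r) ≡ + r
sumFin-point {suc n} zero    r = trans (cong (λ s → + r + s) (sumFin-zero {n})) (ℤP.+-identityʳ (+ r))
sumFin-point {suc n} (suc v) r = trans (ℤP.+-identityˡ _) (sumFin-point v r)

module _ (G : Multigraph) where

  open ≡-Reasoning

  laplacian-*-split : ∀ (z : Fin (n G) → ℤ) u v →
    laplacian G u v * z v ≡ point u 1 v * (+ valence G u * z u) - + mult G u v * z v
  laplacian-*-split z u v with u ≟ᶠ v
  ... | yes refl rewrite point-self u 1 | loopless G u = sym (identity (+ valence G u * z u) (z u))
    where
    identity : ∀ x y → 1ℤ * x - 0ℤ * y ≡ x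
    identity = solve-∀
  ... | no u≢v rewrite point-other {v = u} 1 (u≢v ∘ sym) =
    identity (+ mult G u v) (+ valence G u * z u) (z v)
    where
    identity : ∀ a x y → - a * y ≡ 0ℤ * x - a * y
    identity = solve-∀

  applyLaplacian-edges : ∀ z u →
    applyLaplacian G z u ≡ sumFin (λ v → + mult G u v * (z u - z v))
  applyLaplacian-edges z u = begin
    sumFin (λ v → laplacian G u v * z v)
      ≡⟨ sumFin-cong (laplacian-*-split z u) ⟩
    sumFin (λ v → point u 1 v * c - m v * z v)
      ≡⟨ sumFin-distrib-sub (λ v → point u 1 v * c) (λ v → m v * z v) ⟩
    sumFin (λ v → point u 1 v * c) - outflow
      ≡⟨ cong (_- outflow) (sym (*-distribʳ-sumFin c (point u 1))) ⟩
    sumFin (point u 1) * c - outflow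
      ≡⟨ cong (λ s → s * c - outflow) (sumFin-point u 1) ⟩
    1ℤ * c - outflow
      ≡⟨ cong (_- outflow) (ℤP.*-identityˡ c) ⟩
    c - outflow
      ≡⟨ cong (_- outflow) (trans (cong (_* z u) (pos-sumFinℕ (mult G u))) (*-distribʳ-sumFin (z u) m)) ⟩
    sumFin (λ v → m v * z u) - outflow
      ≡⟨ sumFin-distrib-sub (λ v → m v * z u) (λ v → m v * z v) ⟨
    sumFin (λ v → m v * z u - m v * z v)
      ≡⟨ sumFin-cong (λ v → x[y-z]≈xy-xz (m v) (z u) (z v)) ⟨
    sumFin (λ v → m v * (z u - z v)) ∎
    where
    m : Fin (n G) → ℤ
    m v = + mult G u v
    c : ℤ
    c = + valence G u * z u
    outflow : ℤ
    outflow = sumFin (λ v → m v * z v)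

  applyLaplacian-+ : ∀ z z' u →
    applyLaplacian G (λ v → z v + z' v) u ≡ applyLaplacian G z u + applyLaplacian G z' u
  applyLaplacian-+ z z' u =
    trans (sumFin-cong (λ v → ℤP.*-distribˡ-+ (laplacian G u v) (z v) (z' v)))
          (sumFin-distrib-+ (λ v → laplacian G u v * z v) (λ v → laplacian G u v * z' v))

  applyLaplacian-neg : ∀ z u → applyLaplacian G (λ v → - z v) u ≡ - applyLaplacian G z u
  applyLaplacian-neg z u =
    trans (sumFin-cong (λ v → sym (ℤP.neg-distribʳ-* (laplacian G u v) (z v))))
          (sumFin-neg (λ v → laplacian G u v * z v))

  applyLaplacian-const : ∀ {z c} → (∀ v → z v ≡ c) → ∀ u → applyLaplacian G z u ≡ 0ℤ
  applyLaplacian-const {z} {c} z≡c u = begin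
    applyLaplacian G z u                       ≡⟨ applyLaplacian-edges z u ⟩
    sumFin (λ v → + mult G u v * (z u - z v))  ≡⟨ sumFin-cong no-flow ⟩
    sumFin {n G} (λ _ → 0ℤ)                    ≡⟨ sumFin-zero {n G} ⟩
    0ℤ                                         ∎
    where
    no-flow : ∀ v → + mult G u v * (z u - z v) ≡ 0ℤ
    no-flow v = begin
      + mult G u v * (z u - z v) ≡⟨ cong (λ d → + mult G u v * d) (cong₂ _-_ (z≡c u) (z≡c v)) ⟩
      + mult G u v * (c - c)     ≡⟨ cong (λ d → + mult G u v * d) (ℤP.+-inverseʳ c) ⟩
      + mult G u v * 0ℤ          ≡⟨ ℤP.*-zeroʳ (+ mult G u v) ⟩
      0ℤ                         ∎

  deg-applyLaplacian : ∀ z → deg G (applyLaplacian G z) ≡ 0ℤ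
  deg-applyLaplacian z = begin
    sumFin (applyLaplacian G z)
      ≡⟨ sumFin-cong (λ u → trans (applyLaplacian-edges z u) (split u)) ⟩
    sumFin (λ u → outflow u - inflow u)
      ≡⟨ sumFin-distrib-sub outflow inflow ⟩
    sumFin outflow - sumFin inflow
      ≡⟨ cong (λ s → sumFin outflow - s) inflow≡outflow ⟩
    sumFin outflow - sumFin outflow
      ≡⟨ ℤP.+-inverseʳ (sumFin outflow) ⟩
    0ℤ ∎
    where
    m : Fin (n G) → Fin (n G) → ℤ
    m u v = + mult G u v
    outflow inflow : Fin (n G) → ℤ
    outflow u = sumFin (λ v → m u v * z u)
    inflow  u = sumFin (λ v → m u v * z v)
    split : ∀ u → sumFin (λ v → m u v * (z u - z v)) ≡ outflow u - inflow u
    split u = trans (sumFin-cong (λ v → x[y-z]≈xy-xz (m u v) (z u) (z v)))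
                    (sumFin-distrib-sub (λ v → m u v * z u) (λ v → m u v * z v))
    inflow≡outflow : sumFin inflow ≡ sumFin outflow
    inflow≡outflow = trans (sumFin-comm (λ u v → m u v * z v))
                           (sumFin-cong (λ v → sumFin-cong (λ u → cong (λ e → + e * z v) (symm G u v))))

  ∼-resp : ∀ D D' E E' → (∀ v → D v - D' v ≡ E v - E' v) → _∼_ G D D' → _∼_ G E E'
  ∼-resp _ _ _ _ same (z , D-D'≡Lz) = z , λ v → trans (sym (same v)) (D-D'≡Lz v)

  ∼-refl : ∀ D → _∼_ G D D
  ∼-refl D = (λ _ → 0ℤ) , λ v → trans (ℤP.+-inverseʳ (D v)) (sym (applyLaplacian-const (λ _ → refl) v))

  ∼-sym : ∀ {D D'} → _∼_ G D D' → _∼_ G D' D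
  ∼-sym {D} {D'} (z , D-D'≡Lz) = (λ v → - z v) , λ v → begin
    D' v - D v               ≡⟨ swap (D v) (D' v) ⟩
    - (D v - D' v)           ≡⟨ cong -_ (D-D'≡Lz v) ⟩
    - applyLaplacian G z v   ≡⟨ applyLaplacian-neg z v ⟨
    applyLaplacian G (λ v → - z v) v ∎
    where
    swap : ∀ x y → y - x ≡ - (x - y)
    swap = solve-∀

  ∼-trans : ∀ {D D' D''} → _∼_ G D D' → _∼_ G D' D'' → _∼_ G D D''
  ∼-trans {D} {D'} {D''} (z , D-D'≡Lz) (z' , D'-D''≡Lz') = (λ v → z v + z' v) , λ v → begin
    D v - D'' v                                 ≡⟨ telescope (D v) (D' v) (D'' v) ⟩
    (D v - D' v) + (D' v - D'' v)               ≡⟨ cong₂ _+_ (D-D'≡Lz v) (D'-D''≡Lz' v) ⟩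
    applyLaplacian G z v + applyLaplacian G z' v ≡⟨ applyLaplacian-+ z z' v ⟨
    applyLaplacian G (λ v → z v + z' v) v ∎
    where
    telescope : ∀ x y w → x - w ≡ (x - y) + (y - w)
    telescope = solve-∀

  ∼⇒deg≡ : ∀ {D D'} → _∼_ G D D' → deg G D ≡ deg G D'
  ∼⇒deg≡ {D} {D'} (z , D-D'≡Lz) = ℤP.i-j≡0⇒i≡j _ _ (begin
    sumFin D - sumFin D'              ≡⟨ sumFin-distrib-sub D D' ⟨
    sumFin (λ v → D v - D' v)         ≡⟨ sumFin-cong D-D'≡Lz ⟩
    sumFin (applyLaplacian G z)       ≡⟨ deg-applyLaplacian z ⟩
    0ℤ                                ∎)

  Effective-+ : ∀ {D E} → Effective G D → Effective G E → Effective G (λ v → D v + E v)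
  Effective-+ effD effE v = ℤP.+-mono-≤ (effD v) (effE v)

  RankProperty-⊖ : ∀ {E r} D → RankProperty G D (suc r) → Effective G E → deg G E ≡ + 1 →
                   RankProperty G (_⊖_ G D E) r
  RankProperty-⊖ {E} D rp effE degE≡1 E' effE' degE'≡r
    with rp (λ v → E v + E' v) (Effective-+ effE effE')
            (trans (sumFin-distrib-+ E E') (cong₂ _+_ degE≡1 degE'≡r))
  ... | F , effF , D-[E+E']∼F =
    F , effF , ∼-resp (_⊖_ G D (λ v → E v + E' v)) F (_⊖_ G (_⊖_ G D E) E') F
                      (λ v → regroup (D v) (E v) (E' v) (F v)) D-[E+E']∼F
    where
    regroup : ∀ d e e' f → (d - (e + e')) - f ≡ ((d - e) - e') - f
    regroup = solve-∀

  RankProperty-pred : ∀ {r} D → Fin (n G) → RankProperty G D (suc r) → RankProperty G D r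
  RankProperty-pred D v₀ rp E effE degE≡r
    with RankProperty-⊖ D rp (point-nonneg v₀ 1) (sumFin-point v₀ 1) E effE degE≡r
  ... | F , effF , D-P-E∼F =
    (λ v → F v + point v₀ 1 v) , Effective-+ effF (point-nonneg v₀ 1) ,
    ∼-resp (_⊖_ G (_⊖_ G D (point v₀ 1)) E) F (_⊖_ G D E) (λ v → F v + point v₀ 1 v)
           (λ v → regroup (D v) (point v₀ 1 v) (E v) (F v)) D-P-E∼F
    where
    regroup : ∀ d p e f → ((d - p) - e) - f ≡ (d - e) - (f + p)
    regroup = solve-∀

  RankProperty-antitone : ∀ {r r'} D → Fin (n G) → r ≤ r' → RankProperty G D r' → RankProperty G D r
  RankProperty-antitone {r' = zero}   D v₀ z≤n rp = rp
  RankProperty-antitone {r' = suc r'} D v₀ r≤1+r' rp with ℕP.m≤n⇒m<n∨m≡n r≤1+r'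
  ... | inj₁ (s≤s r≤r') = RankProperty-antitone D v₀ r≤r' (RankProperty-pred D v₀ rp)
  ... | inj₂ refl       = rp

  PositiveRank⇒RankProperty-1 : ∀ D → Fin (n G) → PositiveRank G D → RankProperty G D 1
  PositiveRank⇒RankProperty-1 D v₀ (r , 1≤r , rank≥0 _ rp _) = RankProperty-antitone D v₀ 1≤r rp

  rank-one⇒PositiveRank : ∀ D → Fin (n G) → EquivEffective G D → RankProperty G D 1 →
                          ¬ RankProperty G D 2 → PositiveRank G D
  rank-one⇒PositiveRank D v₀ D≈eff rp1 ¬rp2 =
    1 , s≤s z≤n , rank≥0 D≈eff rp1 (λ r' 2≤r' rp → ¬rp2 (RankProperty-antitone D v₀ 2≤r' rp))

module Star (i k : ℕ) where

  open ≡-Reasoning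

  edges : Fin (suc k) → Fin (suc k) → ℕ
  edges zero    zero    = 0
  edges zero    (suc _) = i
  edges (suc _) zero    = i
  edges (suc _) (suc _) = 0

  edges-symm : ∀ u v → edges u v ≡ edges v u
  edges-symm zero    zero    = refl
  edges-symm zero    (suc _) = refl
  edges-symm (suc _) zero    = refl
  edges-symm (suc _) (suc _) = refl

  edges-loopless : ∀ v → edges v v ≡ 0
  edges-loopless zero    = refl
  edges-loopless (suc _) = refl

  star : Multigraph
  star = record { n = suc k ; mult = edges ; symm = edges-symm ; loopless = edges-loopless }

  star-connected : 1 ≤ i → Connected star
  star-connected 1≤i = s≤s z≤n , λ u v → via-centre u (from-centre v)
    where
    from-centre : ∀ v → Reach star zero v
    from-centre zero    = here
    from-centre (suc _) = step 1≤i here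
    via-centre : ∀ u {v} → Reach star zero v → Reach star u v
    via-centre zero    path = path
    via-centre (suc _) path = step 1≤i path

  applyLaplacian-leaf : ∀ z l → applyLaplacian star z (suc l) ≡ + i * (z (suc l) - z zero)
  applyLaplacian-leaf z l =
    trans (applyLaplacian-edges star z (suc l))
          (trans (cong (λ s → + i * (z (suc l) - z zero) + s) (sumFin-zero {k})) (ℤP.+-identityʳ _))

  applyLaplacian-centre : ∀ z → applyLaplacian star z zero ≡ + i * sumFin (λ l → z zero - z (suc l))
  applyLaplacian-centre z =
    trans (applyLaplacian-edges star z zero)
          (trans (ℤP.+-identityˡ _) (sym (*-distribˡ-sumFin (+ i) (λ l → z zero - z (suc l)))))

  ∼-rigid : ∀ {D D'} → _∼_ star D D' → (∀ v → D v ℤ.< + i) → Effective star D' → ∀ v → D v ≡ D' v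
  ∼-rigid (z , D-D'≡Lz) small effD' v =
    ℤP.i-j≡0⇒i≡j _ _ (trans (D-D'≡Lz v) (applyLaplacian-const star z-const v))
    where
    gap : Fin k → ℤ
    gap l = z zero - z (suc l)
    gap-nonneg : ∀ l → 0ℤ ℤ.≤ gap l
    gap-nonneg l = ℤP.i≤j⇒0≤j-i (ℤP.i-j≤0⇒i≤j {z (suc l)} {z zero}
      (x-y≡c*s⇒s≤0 (small (suc l)) (effD' (suc l)) (trans (D-D'≡Lz (suc l)) (applyLaplacian-leaf z l))))
    gap-sum≤0 : sumFin gap ℤ.≤ 0ℤ
    gap-sum≤0 = x-y≡c*s⇒s≤0 (small zero) (effD' zero) (trans (D-D'≡Lz zero) (applyLaplacian-centre z))
    z-const : ∀ u → z u ≡ z zero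
    z-const zero    = refl
    z-const (suc l) = sym (ℤP.i-j≡0⇒i≡j _ _ (nonneg-sumFin≤0⇒≡0 gap-nonneg gap-sum≤0 l))

  small-representative⇒1≤ : ∀ D D₀ → RankProperty star D 1 → _∼_ star D D₀ →
                             (∀ v → D₀ v ℤ.< + i) → ∀ v → 1ℤ ℤ.≤ D₀ v
  small-representative⇒1≤ D D₀ rp D∼D₀ small v
    with rp (point v 1) (point-nonneg v 1) (sumFin-point v 1)
  ... | F , effF , D-P∼F = ℤP.≤-trans (ℤP.+-mono-≤ (effF v) (ℤP.≤-reflexive (sym (point-self v 1))))
                                      (ℤP.≤-reflexive (sym (D₀≡F+P v)))
    where
    regroup : ∀ d p f → (d - p) - f ≡ d - (f + p)
    regroup = solve-∀
    D∼F+P : _∼_ star D (λ u → F u + point v 1 u)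
    D∼F+P = ∼-resp star (_⊖_ star D (point v 1)) F D (λ u → F u + point v 1 u)
                   (λ u → regroup (D u) (point v 1 u) (F u)) D-P∼F
    D₀≡F+P : ∀ u → D₀ u ≡ F u + point v 1 u
    D₀≡F+P = ∼-rigid (∼-trans star {D₀} {D} (∼-sym star {D} D∼D₀) D∼F+P) small
                     (Effective-+ star {F} effF (point-nonneg v 1))

  ¬RankProperty-2 : ∀ D v → (∀ u → D u - point zero 1 u ℤ.< + i) → D v - point zero 1 v ≡ 0ℤ →
                    ¬ RankProperty star D 2
  ¬RankProperty-2 D v small hole rp =
    1≰0 (subst (1ℤ ℤ.≤_) hole (small-representative⇒1≤ D-P D-P rp1 (∼-refl star D-P) small v))
    where
    D-P : Divisor star
    D-P = _⊖_ star D (point zero 1)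
    rp1 : RankProperty star D-P 1
    rp1 = RankProperty-⊖ star D rp (point-nonneg zero 1) (sumFin-point {suc k} zero 1)
    1≰0 : ¬ (1ℤ ℤ.≤ 0ℤ)
    1≰0 (+≤+ ())

  centre-RankProperty-1 : 1 ≤ i → RankProperty star (point zero i) 1
  centre-RankProperty-1 1≤i E effE degE≡1 = F , effF , z , firing
    where
    c : ℤ
    c = + i - 1ℤ
    F : Divisor star
    F v = c * E v
    effF : Effective star F
    effF v = ℤP.≤-trans (ℤP.≤-reflexive (sym (ℤP.*-zeroʳ c)))
                        (ℤP.*-monoˡ-≤-nonNeg c {{ℤ.nonNegative (ℤP.i≤j⇒0≤j-i (+≤+ 1≤i))}} (effE v))
    -- each leaf ℓ borrows E(ℓ) times, so i·(centre) − E ∼ (i − 1)·E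
    z : Fin (suc k) → ℤ
    z zero    = 0ℤ
    z (suc l) = - E (suc l)
    leaves : sumFin (λ l → z zero - z (suc l)) ≡ 1ℤ - E zero
    leaves = begin
      sumFin (λ l → 0ℤ - - E (suc l))          ≡⟨ sumFin-cong (λ l → double-neg (E (suc l))) ⟩
      sumFin (E ∘ suc)                         ≡⟨ cancel (E zero) (sumFin (E ∘ suc)) ⟩
      (E zero + sumFin (E ∘ suc)) - E zero     ≡⟨ cong (_- E zero) degE≡1 ⟩
      1ℤ - E zero                              ∎
      where
      double-neg : ∀ x → 0ℤ - - x ≡ x
      double-neg = solve-∀
      cancel : ∀ a s → s ≡ (a + s) - a
      cancel = solve-∀
    firing : ∀ v → (point zero i v - E v) - F v ≡ applyLaplacian star z v
    firing zero = begin
      (+ i - E zero) - c * E zero              ≡⟨ centre-identity (+ i) (E zero) ⟩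
      + i * (1ℤ - E zero)                      ≡⟨ cong (+ i *_) leaves ⟨
      + i * sumFin (λ l → z zero - z (suc l))  ≡⟨ applyLaplacian-centre z ⟨
      applyLaplacian star z zero               ∎
      where
      centre-identity : ∀ I e → (I - e) - (I - 1ℤ) * e ≡ I * (1ℤ - e)
      centre-identity = solve-∀
    firing (suc l) = trans (leaf-identity (+ i) (E (suc l))) (sym (applyLaplacian-leaf z l))
      where
      leaf-identity : ∀ I e → (0ℤ - e) - (I - 1ℤ) * e ≡ I * (- e - 0ℤ)
      leaf-identity = solve-∀

  centre-PositiveRank : 1 ≤ i → Fin k → PositiveRank star (point zero i)
  centre-PositiveRank 1≤i leaf =
    rank-one⇒PositiveRank star (point zero i) zero
      (point zero i , point-nonneg zero i , ∼-refl star (point zero i))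
      (centre-RankProperty-1 1≤i) (¬RankProperty-2 (point zero i) (suc leaf) small refl)
    where
    small : ∀ u → point zero i u - point zero 1 u ℤ.< + i
    small zero    = ℤP.m⊖1+n<m i 1
    small (suc _) = +<+ 1≤i

  ones : Divisor star
  ones _ = 1ℤ

  ones-multiplicityFree : MultiplicityFree star ones
  ones-multiplicityFree = (λ _ → +≤+ z≤n) , (λ _ → ℤP.≤-refl)

  ones-RankProperty-1 : RankProperty star ones 1
  ones-RankProperty-1 E effE degE≡1 =
    _⊖_ star ones E , (λ v → ℤP.i≤j⇒0≤j-i (subst (E v ℤ.≤_) degE≡1 (entry≤sumFin effE v))) ,
    ∼-refl star (_⊖_ star ones E)

  ones-PositiveRank : 2 ≤ i → PositiveRank star ones
  ones-PositiveRank 2≤i =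
    rank-one⇒PositiveRank star ones zero (ones , (λ _ → +≤+ z≤n) , ∼-refl star ones)
      ones-RankProperty-1 (¬RankProperty-2 ones zero small refl)
    where
    small : ∀ u → 1ℤ - point zero 1 u ℤ.< + i
    small zero    = +<+ (ℕP.≤-trans (s≤s z≤n) 2≤i)
    small (suc _) = +<+ 2≤i

  PositiveRank⇒i≤deg : i ≤ suc k → ∀ D → PositiveRank star D → + i ℤ.≤ deg star D
  PositiveRank⇒i≤deg i≤n D posD@(_ , _ , rank≥0 (D₀ , effD₀ , D∼D₀) _ _) =
    ℤP.≤-trans i≤degD₀ (ℤP.≤-reflexive (sym (∼⇒deg≡ star {D} D∼D₀)))
    where
    rp1 : RankProperty star D 1
    rp1 = PositiveRank⇒RankProperty-1 star D zero posD
    i≤degD₀ : + i ℤ.≤ deg star D₀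
    i≤degD₀ with all? (λ v → D₀ v ℤP.<? + i)
    ... | yes small = ℤP.≤-trans (+≤+ i≤n) (n≤sumFin (small-representative⇒1≤ D D₀ rp1 D∼D₀ small))
    ... | no ¬small with ¬∀⟶∃¬ (suc k) _ (λ v → D₀ v ℤP.<? + i) ¬small
    ...   | v , D₀v≮i = ℤP.≤-trans (ℤP.≮⇒≥ D₀v≮i) (entry≤sumFin effD₀ v)

  multiplicityFree-PositiveRank⇒n≤deg : 2 ≤ i → ∀ D → MultiplicityFree star D → PositiveRank star D →
                                         + suc k ℤ.≤ deg star D
  multiplicityFree-PositiveRank⇒n≤deg 2≤i D (_ , D≤1) posD =
    n≤sumFin (small-representative⇒1≤ D D (PositiveRank⇒RankProperty-1 star D zero posD) (∼-refl star D)
               (λ v → ℤP.≤-<-trans (D≤1 v) (+<+ 2≤i)))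

proposition4p1 : ∀ (i j : ℕ) → 2 ≤ i → i ≤ j →
    Σ Multigraph λ G → Connected G × IsGon G i × IsMfgon G j
proposition4p1 i (suc k@(suc _)) 2≤i@(s≤s (s≤s _)) i≤j@(s≤s (s≤s _)) =
  star , star-connected 1≤i ,
  ((point zero i , centre-PositiveRank 1≤i zero , sumFin-point {suc k} zero i) ,
   PositiveRank⇒i≤deg i≤j) ,
  ((ones , ones-multiplicityFree , ones-PositiveRank 2≤i , sumFin-one) ,
   multiplicityFree-PositiveRank⇒n≤deg 2≤i)
  where
  open Star i k
  1≤i : 1 ≤ i
  1≤i = ℕP.≤-trans (s≤s z≤n) 2≤i
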